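{- Let $L\ge2$, $n\ge2$ be integers. For any integers $0\le g\le L-2$ and $0\le t\le n-2$, $\xi_{(g+1)L^t}(K_L^n)-\xi_{gL^t}(K_L^n)\ge 0$.
   Context: $K_L^n$ is the graph on strings $x_n\cdots x_1$ over $\{0,\dots,L-1\}$, adjacent iff they differ in exactly one coordinate. For an integer $0\le m\le L^n$ with base-$L$ expansion $m=\sum_{i=0}^{s}a_iL^{b_i}$ ($a_i\in\{1,\dots,L-1\}$, $b_0>\dots>b_s\ge0$) let $ex_m(K_L^n)=\sum_{i=0}^{s}[(L-1)a_ib_iL^{b_i}+(a_i-1)a_iL^{b_i}]+2\sum_{i=0}^{s-1}\sum_{k=i+1}^{s}a_ia_kL^{b_k}$ ($ex_0=0$), and $\xi_m(K_L^n)=(L-1)nm-ex_m(K_L^n)$ (so $\xi_0=0$). -}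

module Defs where

open import Data.Nat using (ℕ; zero; suc; _+_; _*_; _∸_; _^_; NonZero; _≟_)
open import Data.Nat.DivMod using (_/_; _%_)
open import Data.Nat.Properties using (m^n≢0)
open import Data.List using (List; []; _∷_; map; reverse; upTo; filter)
open import Data.Nat.ListAction using (sum)
open import Data.Product using (_×_; _,_)
open import Data.Integer using (ℤ; +_; _-_)
open import Relation.Nullary using (¬?)

digit : (L : ℕ) .{{_ : NonZero L}} → ℕ → ℕ → ℕ
digit L m j = ((m / (L ^ j)) {{m^n≢0 L j}}) % L

-- Positions 0..m suffice since L^j > m for j > m.
expansion : (L : ℕ) .{{_ : NonZero L}} → ℕ → List (ℕ × ℕ)
expansion L m =
  filter (λ p → ¬? (Data.Product.proj₁ p ≟ 0))
         (map (λ j → (digit L m j , j)) (reverse (upTo (suc m))))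

exSingle : ℕ → List (ℕ × ℕ) → ℕ
exSingle L [] = 0
exSingle L ((a , b) ∷ rest) =
  ((L ∸ 1) * a * b * L ^ b + (a ∸ 1) * a * L ^ b) + exSingle L rest

exPairs : ℕ → List (ℕ × ℕ) → ℕ
exPairs L [] = 0
exPairs L ((a , b) ∷ rest) =
  sum (map (λ q → 2 * a * Data.Product.proj₁ q * L ^ Data.Product.proj₂ q) rest)
  + exPairs L rest

-- ex_m(K_L^n)  (independent of n); ex_0 = 0 since the expansion of 0 is empty
ex : (L : ℕ) .{{_ : NonZero L}} → ℕ → ℕ
ex L m = exSingle L (expansion L m) + exPairs L (expansion L m)

ξ : (L : ℕ) .{{_ : NonZero L}} → (n m : ℕ) → ℤ
ξ L n m = + ((L ∸ 1) * n * m) - + (ex L m)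

{-# OPTIONS --safe #-}
-- A number a·L^t with a single nonzero base-L digit has ex = (L-1)·a·t·L^t + (a-1)·a·L^t, so
-- raising the digit from g to g+1 increases ex by ((L-1)·t + 2g)·L^t, while (L-1)·n·m grows by
-- (L-1)·n·L^t.  The difference is ((L-1)(n-t) - 2g)·L^t ≥ 0 because n - t ≥ 2 and g ≤ L-2.
module Submission where

open import Defs
open import Data.Nat using (ℕ; suc; _+_; _*_; _∸_; _^_; _≤_; NonZero)
open import Data.Integer using (ℤ; +_; _-_; +≤+) renaming (_≤_ to _≤ℤ_; _+_ to _+ℤ_)

open import Data.Nat as ℕ using (zero; _<_; z≤n; s≤s; _≟_)
open import Data.Nat.Properties
open import Data.Nat.DivMod
open import Data.List using (List; []; _∷_; map; filter; downFrom)
open import Data.List.Properties using (reverse-upTo; filter-accept; filter-reject)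
open import Data.Product using (_×_; _,_; proj₁)
open import Relation.Binary.PropositionalEquality
open import Function using (_∘_)
open import Relation.Nullary using (Dec; ¬?; yes; no)
import Data.Integer.Properties as ℤ
import Data.Nat.Tactic.RingSolver as ℕ-Ring
import Data.Integer.Tactic.RingSolver as ℤ-Ring

n<m^n : ∀ m → 1 < m → ∀ n → n < m ^ n
n<m^n m 1<m zero    = s≤s z≤n
n<m^n m 1<m (suc n) = ≤-trans (s≤s (n<m^n m 1<m n)) (^-monoʳ-< m 1<m (n<1+n n))

-- For a = 0 the truncated subtraction makes this 0, matching ex_0 = 0.
exDigit : ℕ → ℕ → ℕ → ℕ
exDigit L a t = (L ∸ 1) * a * t * L ^ t + (a ∸ 1) * a * L ^ t

exDigit-zero : ∀ L t → exDigit L 0 t ≡ 0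
exDigit-zero L t = cong (λ x → x * t * L ^ t + 0) (*-zeroʳ (L ∸ 1))

exDigit-suc : ∀ L a t →
  exDigit L (suc a) t ≡ exDigit L a t + ((L ∸ 1) * t + 2 * a) * L ^ t
exDigit-suc L zero    t = first-step (L ∸ 1) t (L ^ t)
  where
  first-step : ∀ c t P → c * 1 * t * P + 0 ≡ (c * 0 * t * P + 0) + (c * t + 0) * P
  first-step = ℕ-Ring.solve-∀
exDigit-suc L (suc a) t = later-step (L ∸ 1) t (L ^ t) a
  where
  later-step : ∀ c t P a →
    c * suc (suc a) * t * P + suc a * suc (suc a) * P
      ≡ (c * suc a * t * P + a * suc a * P) + (c * t + 2 * suc a) * P
  later-step = ℕ-Ring.solve-∀

module BaseExpansion (L : ℕ) .{{_ : NonZero L}} where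

  nonzero? : (p : ℕ × ℕ) → Dec (proj₁ p ≢ 0)
  nonzero? p = ¬? (proj₁ p ≟ 0)

  digit-at : ∀ a t → a < L → digit L (a * L ^ t) t ≡ a
  digit-at a t a<L =
    trans (cong (_% L) (m*n/n≡m a (L ^ t) {{m^n≢0 L t}})) (m<n⇒m%n≡m a<L)

  digit-below : ∀ a t j → j < t → digit L (a * L ^ t) j ≡ 0
  digit-below a t j j<t with m≤n⇒∃[o]m+o≡n j<t
  ... | d , refl = trans (cong (_% L) quotient) (m*n%n≡0 (a * L ^ d) L)
    where
    instance _ = m^n≢0 L j
    quotient : a * L ^ (suc j + d) / L ^ j ≡ a * L ^ d * L
    quotient = begin
      a * L ^ (suc j + d) / L ^ j     ≡⟨ cong (λ x → a * x / L ^ j) (^-distribˡ-+-* L (suc j) d) ⟩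
      a * (L * L ^ j * L ^ d) / L ^ j ≡⟨ cong (_/ L ^ j) (rearrange a L (L ^ j) (L ^ d)) ⟩
      a * L ^ d * L * L ^ j / L ^ j   ≡⟨ m*n/n≡m (a * L ^ d * L) (L ^ j) ⟩
      a * L ^ d * L                   ∎
      where
      open ≡-Reasoning
      rearrange : ∀ a x y z → a * (x * y * z) ≡ a * z * x * y
      rearrange = ℕ-Ring.solve-∀

  digit-above : ∀ a t j → a < L → t < j → digit L (a * L ^ t) j ≡ 0
  digit-above a t j a<L t<j =
    trans (cong (_% L) (m<n⇒m/n≡0 {{m^n≢0 L j}} a*L^t<L^j)) (m*n%n≡0 0 L)
    where
    a*L^t<L^j : a * L ^ t < L ^ j
    a*L^t<L^j = ≤-trans (*-monoˡ-< (L ^ t) {{m^n≢0 L t}} a<L) (^-monoʳ-≤ L t<j)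

  nonzeroDigits : ℕ → ℕ → List (ℕ × ℕ)
  nonzeroDigits m k = filter nonzero? (map (λ j → digit L m j , j) (downFrom k))

  expansion-nonzeroDigits : ∀ m → expansion L m ≡ nonzeroDigits m (suc m)
  expansion-nonzeroDigits m =
    cong (λ js → filter nonzero? (map (λ j → (digit L m j , j)) js))
         (reverse-upTo (suc m))

  nonzeroDigits-none : ∀ m k → (∀ j → j < k → digit L m j ≡ 0) → nonzeroDigits m k ≡ []
  nonzeroDigits-none m zero    _    = refl
  nonzeroDigits-none m (suc k) below-k =
    trans (filter-reject nonzero? (λ d≢0 → d≢0 (below-k k ≤-refl)))
          (nonzeroDigits-none m k (λ j j<k → below-k j (m≤n⇒m≤1+n j<k)))

  nonzeroDigits-single : ∀ a t k → 0 < a → a < L → t < k →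
    nonzeroDigits (a * L ^ t) k ≡ (a , t) ∷ []
  nonzeroDigits-single a t (suc k) 0<a a<L t<1+k with k ≟ t
  ... | yes refl =
    trans (filter-accept nonzero? (subst (_≢ 0) (sym (digit-at a t a<L)) (>⇒≢ 0<a)))
          (cong₂ _∷_ (cong (_, t) (digit-at a t a<L))
                     (nonzeroDigits-none (a * L ^ t) t (digit-below a t)))
  ... | no k≢t =
    trans (filter-reject nonzero? (λ d≢0 → d≢0 (digit-above a t k a<L t<k)))
          (nonzeroDigits-single a t k 0<a a<L t<k)
    where
    t<k : t < k
    t<k = ≤∧≢⇒< (ℕ.s≤s⁻¹ t<1+k) (k≢t ∘ sym)

  expansion-zero : expansion L 0 ≡ []
  expansion-zero = trans (expansion-nonzeroDigits 0) (nonzeroDigits-none 0 1 (digit-below 0 1))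

  expansion-single : ∀ a t → 0 < a → a < L → expansion L (a * L ^ t) ≡ (a , t) ∷ []
  expansion-single a@(suc _) t 0<a a<L =
    trans (expansion-nonzeroDigits (a * L ^ t))
          (nonzeroDigits-single a t (suc (a * L ^ t)) 0<a a<L t<1+a*L^t)
    where
    t<1+a*L^t : t < suc (a * L ^ t)
    t<1+a*L^t = m≤n⇒m≤1+n (≤-trans (n<m^n L 1<L t) (m≤m+n (L ^ t) _))
      where 1<L = ≤-trans (s≤s (s≤s z≤n)) a<L

  ex-single : ∀ a t → a < L → ex L (a * L ^ t) ≡ exDigit L a t
  ex-single zero        t _   =
    trans (cong (λ e → exSingle L e + exPairs L e) expansion-zero) (sym (exDigit-zero L t))
  ex-single a@(suc _) t a<L =
    trans (cong (λ e → exSingle L e + exPairs L e) (expansion-single a t (s≤s z≤n) a<L))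
          (trans (+-identityʳ _) (+-identityʳ _))

  ex-next : ∀ g t → suc g < L →
    ex L (suc g * L ^ t) ≡ ex L (g * L ^ t) + ((L ∸ 1) * t + 2 * g) * L ^ t
  ex-next g t 1+g<L = begin
    ex L (suc g * L ^ t)                 ≡⟨ ex-single (suc g) t 1+g<L ⟩
    exDigit L (suc g) t                  ≡⟨ exDigit-suc L g t ⟩
    exDigit L g t + increment            ≡⟨ cong (_+ increment) (ex-single g t g<L) ⟨
    ex L (g * L ^ t) + increment         ∎
    where
    open ≡-Reasoning
    increment = ((L ∸ 1) * t + 2 * g) * L ^ t
    g<L = <-trans (n<1+n g) 1+g<L

  ξ-step : ∀ n m P d → ex L (P + m) ≡ ex L m + d →
    ξ L n (P + m) - ξ L n m ≡ + ((L ∸ 1) * n * P) - + d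
  ξ-step n m P d ex-step = begin
    (+ (k * (P + m)) - + ex L (P + m)) - (+ (k * m) - + ex L m)
      ≡⟨ cong₂ (λ x y → (+ x - + y) - (+ (k * m) - + ex L m)) (*-distribˡ-+ k P m) ex-step ⟩
    (+ (k * P + k * m) - + (ex L m + d)) - (+ (k * m) - + ex L m)
      ≡⟨ cong₂ (λ x y → (x - y) - (+ (k * m) - + ex L m))
               (ℤ.pos-+ (k * P) (k * m)) (ℤ.pos-+ (ex L m) d) ⟩
    ((+ (k * P) +ℤ + (k * m)) - (+ ex L m +ℤ + d)) - (+ (k * m) - + ex L m)
      ≡⟨ cancel (+ (k * P)) (+ (k * m)) (+ ex L m) (+ d) ⟩
    + (k * P) - + d ∎
    where
    open ≡-Reasoning
    k = (L ∸ 1) * n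
    cancel : ∀ x y e d → ((x +ℤ y) - (e +ℤ d)) - (y - e) ≡ x - d
    cancel = ℤ-Ring.solve-∀

step-bound : ∀ c n t g → g ≤ c → t + 2 ≤ n → c * t + 2 * g ≤ c * n
step-bound c n t g g≤c t+2≤n = begin
  c * t + 2 * g ≤⟨ +-monoʳ-≤ (c * t) (*-monoʳ-≤ 2 g≤c) ⟩
  c * t + 2 * c ≡⟨ cong (_+_ (c * t)) (*-comm 2 c) ⟩
  c * t + c * 2 ≡⟨ *-distribˡ-+ c t 2 ⟨
  c * (t + 2)   ≤⟨ *-monoʳ-≤ c t+2≤n ⟩
  c * n         ∎
  where open ≤-Reasoning

mainTheorem3 : (L n : ℕ) .{{_ : NonZero L}} → 2 ≤ L → 2 ≤ n →
    (g t : ℕ) → g ≤ L ∸ 2 → t ≤ n ∸ 2 →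
    + 0 ≤ℤ ξ L n (suc g * L ^ t) - ξ L n (g * L ^ t)
mainTheorem3 L n 2≤L 2≤n g t g≤L∸2 t≤n∸2 =
  subst (+ 0 ≤ℤ_) (sym (ξ-step n (g * L ^ t) (L ^ t) _ (ex-next g t 1+g<L)))
        (ℤ.i≤j⇒0≤j-i (+≤+ increment≤))
  where
  open BaseExpansion L
  1+g<L : suc g < L
  1+g<L = subst (_≤ L) (+-comm g 2) (m≤o∸n⇒m+n≤o g 2≤L g≤L∸2)
  increment≤ : ((L ∸ 1) * t + 2 * g) * L ^ t ≤ (L ∸ 1) * n * L ^ t
  increment≤ = *-monoˡ-≤ (L ^ t) (step-bound (L ∸ 1) n t g
    (≤-trans g≤L∸2 (∸-monoʳ-≤ L (s≤s z≤n))) (m≤o∸n⇒m+n≤o t 2≤n t≤n∸2))
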